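{- Let $n\ge 1$ and $k,l,m$ be integers with $\gcd(k,l,m,n)=1$, and let $\Delta(n;k,l,m)$ be the $\Delta$-graph defined in the context. Let $I=I_n$ be the $n\times n$ identity matrix and $T=\mathrm{circ}(0,1,0,\ldots,0)$ the $n\times n$ cyclic shift matrix. Put $A=4I-T^{k}-T^{ -k}$, $B=4I-T^{l}-T^{ -l}$, $C=4I-T^{m}-T^{ -m}$, and let $M$ be the $2n\times 2n$ integer block matrix $$M=\begin{pmatrix} -I-A & I+B\\ -I+CA & -I-C\end{pmatrix}.$$ Then the Jacobian group $\mathrm{Jac}(\Delta(n;k,l,m))$ is isomorphic to the torsion subgroup of $\mathrm{coker}(M)=\mathbb{Z}^{2n}/M\mathbb{Z}^{2n}$.
   Context: The $\Delta$-graph $\Delta(n;k,l,m)$ has $3n$ vertices $v_{x,y}$, $x\in\{1,2,3\}$, $y\in\mathbb{Z}/n\mathbb{Z}$. For each fixed $x$, each $v_{x,y}$ is joined to $v_{x,y+j(x)}$, where $j(1)=k$, $j(2)=l$, $j(3)=m$ (indices mod $n$); for each fixed $y$, the three vertices $v_{1,y},v_{2,y},v_{3,y}$ form a triangle. The graph is connected when $\gcd(k,l,m,n)=1$. With vertices ordered in three blocks by $x$, its Laplacian matrix $L=D-A(G)$ (degree matrix minus adjacency matrix) is the $3n\times 3n$ block matrix $L=\begin{pmatrix} A&-I&-I\\-I&B&-I\\-I&-I&C\end{pmatrix}$ with $A,B,C$ as in the claim. For an integer square matrix $N$ of size $r$, $\mathrm{coker}(N)=\mathbb{Z}^r/N\mathbb{Z}^r$.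 The Jacobian group $\mathrm{Jac}(G)$ of a connected graph $G$ is the torsion subgroup of $\mathrm{coker}(L(G))$. The matrix $\mathrm{circ}(a_0,\ldots,a_{n-1})$ is the circulant matrix whose first row is $(a_0,\ldots,a_{n-1})$ and each subsequent row is the previous one shifted cyclically one step to the right. -}

module Defs where

open import Level using (0ℓ)
open import Data.Nat as ℕ using (ℕ; zero; suc; _≤_; s≤s; z≤n)
import Data.Nat.Properties as ℕP
import Data.Integer.Properties as ZP
open import Data.Nat.Divisibility as ℕD using (_∣?_)
open import Data.Integer as ℤ using (ℤ; +_; _+_; _*_; _-_; -_; ∣_∣)
open import Data.Integer.Tactic.RingSolver using (solve-∀)
open import Data.Fin using (Fin; zero; suc; toℕ; remQuot)
open import Data.Product using (Σ; ∃; _×_; _,_; proj₁; proj₂)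
open import Relation.Nullary.Decidable using (Dec; yes; no; ⌊_⌋)
open import Relation.Binary.PropositionalEquality
open import Algebra.Bundles.Raw using (RawGroup)

Σ[_] : ∀ {r} → (Fin r → ℤ) → ℤ
Σ[_] {zero}  f = + 0
Σ[_] {suc r} f = f zero + Σ[ (λ j → f (suc j)) ]

Vector : ℕ → Set
Vector r = Fin r → ℤ

Matrix : ℕ → Set
Matrix r = Fin r → Fin r → ℤ

_·v_ : ∀ {r} → Matrix r → Vector r → Vector r
(N ·v u) i = Σ[ (λ j → N i j * u j) ]

𝟙 : ∀ {r} → Matrix r
𝟙 i j with Data.Fin._≟_ i j
... | yes _ = + 1
... | no  _ = + 0

_⊕_ _⊖_ _⊗_ : ∀ {r} → Matrix r → Matrix r → Matrix r
(P ⊕ Q) i j = P i j + Q i j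
(P ⊖ Q) i j = P i j - Q i j
(P ⊗ Q) i j = Σ[ (λ t → P i t * Q t j) ]

⊝_ : ∀ {r} → Matrix r → Matrix r
(⊝ P) i j = - P i j

_⊛_ : ∀ {r} → ℤ → Matrix r → Matrix r
(c ⊛ P) i j = c * P i j

_^ᴹ_ : ∀ {r} → Matrix r → ℕ → Matrix r
P ^ᴹ zero  = 𝟙
P ^ᴹ suc e = P ⊗ (P ^ᴹ e)

[_≡_mod_] : ℤ → ℤ → ℕ → ℤ
[ a ≡ b mod n ] with n ∣? ∣ a - b ∣
... | yes _ = + 1
... | no  _ = + 0

T : (n : ℕ) → Matrix n
T n i j = [ + toℕ j ≡ + toℕ i + + 1 mod n ]

T⁻¹ : (n : ℕ) → Matrix n
T⁻¹ n i j = [ + toℕ j ≡ + toℕ i - + 1 mod n ]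

Tpow : (n : ℕ) → ℤ → Matrix n
Tpow n (+ e)      = T n ^ᴹ e
Tpow n ℤ.-[1+ e ] = T⁻¹ n ^ᴹ suc e

blockMat : (n : ℕ) → ℤ → Matrix n
blockMat n j = (((+ 4) ⊛ 𝟙) ⊖ Tpow n j) ⊖ Tpow n (- j)

-- The Δ-graph Δ(n;k,l,m) and its Laplacian.
-- Vertex v_{x,y} (x ∈ {1,2,3} ↦ Fin 3, y ∈ ℤ/nℤ ↦ Fin n) is the index
-- of Fin (3 * n) given by  remQuot n  (blocks ordered by x).

jump : ℤ → ℤ → ℤ → Fin 3 → ℤ
jump k l m zero             = k
jump k l m (suc zero)       = l
jump k l m (suc (suc zero)) = m

-- adjacency matrix (edge multiplicities; a loop counts 2 as usual):
--   same x : edges y — y+j(x)  (one edge for each y)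
--   same y, x ≠ x' : triangle edge
adjBlock : (n : ℕ) → ℤ → ℤ → ℤ → Fin 3 → Fin 3 → Fin n → Fin n → ℤ
adjBlock n k l m x x' y y' with Data.Fin._≟_ x x'
... | yes _ = [ + toℕ y' ≡ + toℕ y + jump k l m x mod n ]
            + [ + toℕ y ≡ + toℕ y' + jump k l m x mod n ]
... | no  _ with Data.Fin._≟_ y y'
...   | yes _ = + 1
...   | no  _ = + 0

ΔAdj : (n : ℕ) → ℤ → ℤ → ℤ → Matrix (3 ℕ.* n)
ΔAdj n k l m v w =
  adjBlock n k l m (proj₁ (remQuot {3} n v)) (proj₁ (remQuot {3} n w))
                   (proj₂ (remQuot {3} n v)) (proj₂ (remQuot {3} n w))

ΔLaplacian : (n : ℕ) → ℤ → ℤ → ℤ → Matrix (3 ℕ.* n)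
ΔLaplacian n k l m v w with Data.Fin._≟_ v w
... | yes _ = Σ[ ΔAdj n k l m v ] - ΔAdj n k l m v w
... | no  _ = - ΔAdj n k l m v w

MBlocks : (n : ℕ) → ℤ → ℤ → ℤ → Fin 2 → Fin 2 → Matrix n
MBlocks n k l m zero       zero       = (⊝ 𝟙) ⊖ blockMat n k
MBlocks n k l m zero       (suc zero) = 𝟙 ⊕ blockMat n l
MBlocks n k l m (suc zero) zero       = (⊝ 𝟙) ⊕ (blockMat n m ⊗ blockMat n k)
MBlocks n k l m (suc zero) (suc zero) = (⊝ 𝟙) ⊖ blockMat n m

MMat : (n : ℕ) → ℤ → ℤ → ℤ → Matrix (2 ℕ.* n)
MMat n k l m i j =
  MBlocks n k l m (proj₁ (remQuot {2} n i)) (proj₁ (remQuot {2} n j))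
                  (proj₂ (remQuot {2} n i)) (proj₂ (remQuot {2} n j))

InImage : ∀ {r} → Matrix r → Vector r → Set
InImage N v = ∃ λ u → ∀ i → v i ≡ (N ·v u) i

_≈[_]_ : ∀ {r} → Vector r → Matrix r → Vector r → Set
v ≈[ N ] w = InImage N (λ i → v i - w i)

IsTorsion : ∀ {r} → Matrix r → Vector r → Set
IsTorsion N v = ∃ λ (c : ℕ) → 1 ≤ c × InImage N (λ i → + c * v i)

private
  Σ-cong : ∀ {r} {f g : Fin r → ℤ} → (∀ j → f j ≡ g j) → Σ[ f ] ≡ Σ[ g ]
  Σ-cong {zero}  e = refl
  Σ-cong {suc r} e = cong₂ _+_ (e zero) (Σ-cong (λ j → e (suc j)))

  Σ-lin : ∀ {r} (a b : ℤ) (f g : Fin r → ℤ) →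
          Σ[ (λ j → a * f j + b * g j) ] ≡ a * Σ[ f ] + b * Σ[ g ]
  Σ-lin {zero}  a b f g = z a b
    where
    z : ∀ a b → + 0 ≡ a * + 0 + b * + 0
    z = solve-∀
  Σ-lin {suc r} a b f g =
    trans (cong (λ z → a * f zero + b * g zero + z)
                (Σ-lin a b (λ j → f (suc j)) (λ j → g (suc j))))
          (lem a b (f zero) (g zero) Σ[ (λ j → f (suc j)) ] Σ[ (λ j → g (suc j)) ])
    where
    lem : ∀ a b x y s t → a * x + b * y + (a * s + b * t) ≡ a * (x + s) + b * (y + t)
    lem = solve-∀

  ·v-lin : ∀ {r} (N : Matrix r) (a b : ℤ) (x y : Vector r) i →
           (N ·v (λ j → a * x j + b * y j)) i ≡ a * (N ·v x) i + b * (N ·v y) i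
  ·v-lin N a b x y i =
    trans (Σ-cong (λ j → lem a b (N i j) (x j) (y j)))
          (Σ-lin a b (λ j → N i j * x j) (λ j → N i j * y j))
    where
    lem : ∀ a b p s t → p * (a * s + b * t) ≡ a * (p * s) + b * (p * t)
    lem = solve-∀

  tors-0 : ∀ {r} (N : Matrix r) → IsTorsion N (λ _ → + 0)
  tors-0 N = 1 , s≤s z≤n , (λ _ → + 0) ,
    λ i → sym (trans (cong (λ z → z) (Σ-cong (λ j → lem (N i j))))
                     (trans (Σ-lin (+ 0) (+ 0) (N i) (N i)) refl))
    where
    lem : ∀ p → p * + 0 ≡ + 0 * p + + 0 * p
    lem = solve-∀

  tors-+ : ∀ {r} (N : Matrix r) (v w : Vector r) → IsTorsion N v → IsTorsion N w →
           IsTorsion N (λ i → v i + w i)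
  tors-+ N v w (c , c≥1 , u , eu) (d , d≥1 , u' , eu') =
    c ℕ.* d , ℕP.*-mono-≤ c≥1 d≥1 , (λ j → + d * u j + + c * u' j) ,
    λ i → trans (lem (v i) (w i))
           (trans (cong₂ (λ p q → + d * p + + c * q) (eu i) (eu' i))
                  (sym (·v-lin N (+ d) (+ c) u u' i)))
    where
    lem : ∀ s t → + (c ℕ.* d) * (s + t) ≡ + d * (+ c * s) + + c * (+ d * t)
    lem s t = trans (cong (λ z → z * (s + t)) (ZP.pos-* c d)) (help (+ c) (+ d) s t)
      where
      help : ∀ p q s t → p * q * (s + t) ≡ q * (p * s) + p * (q * t)
      help = solve-∀

  tors-neg : ∀ {r} (N : Matrix r) (v : Vector r) → IsTorsion N v →
             IsTorsion N (λ i → - v i)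
  tors-neg N v (c , c≥1 , u , eu) =
    c , c≥1 , (λ j → - + 1 * u j + + 0 * u j) ,
    λ i → trans (lem (+ c) (v i))
           (trans (cong (λ p → - + 1 * p + + 0 * p) (eu i))
                  (sym (·v-lin N (- + 1) (+ 0) u u i)))
    where
    lem : ∀ p s → p * (- s) ≡ - + 1 * (p * s) + + 0 * (p * s)
    lem = solve-∀

-- The torsion subgroup of coker(N), as a (raw) group: elements are
-- representatives v ∈ ℤ^r of torsion classes, equality is equality in coker(N).
TorsCoker : ∀ {r} → Matrix r → RawGroup 0ℓ 0ℓ
TorsCoker {r} N = record
  { Carrier = Σ (Vector r) (IsTorsion N)
  ; _≈_     = λ a b → proj₁ a ≈[ N ] proj₁ b
  ; _∙_     = λ a b → (λ i → proj₁ a i + proj₁ b i)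
                    , tors-+ N (proj₁ a) (proj₁ b) (proj₂ a) (proj₂ b)
  ; ε       = (λ _ → + 0) , tors-0 N
  ; _⁻¹     = λ a → (λ i → - proj₁ a i) , tors-neg N (proj₁ a) (proj₂ a)
  }

JacΔ : (n : ℕ) → ℤ → ℤ → ℤ → RawGroup 0ℓ 0ℓ
JacΔ n k l m = TorsCoker (ΔLaplacian n k l m)

{-# OPTIONS --safe #-}
-- In block form L = [[A,-I,-I],[-I,B,-I],[-I,-I,C]]; this follows from the degree of every vertex being 4
-- and from T^j being the shift matrix i ↦ i + j (mod n). The unimodular row operation
-- E = [[I,0,0],[-I,I,0],[C,0,I]] turns L into [[A,-I,-I],[M,0]], and the block -I in the top right corner
-- makes the first block row and the last block column of E L redundant. Concretely, with blocks numbered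
-- 0, 1, 2, the map v ↦ (v₁ - v₀, v₂ + C v₀) from ℤ³ⁿ onto ℤ²ⁿ has a linear section, maps im L into im M,
-- and pulls im M back into im L; so it induces coker L ≅ coker M, which restricts to the torsion subgroups.
module Submission where

open import Defs
open import Data.Nat as ℕ using (ℕ; zero; suc; _≤_)
import Data.Nat.Properties as ℕP
import Data.Nat.Divisibility as ℕD
open import Data.Nat.GCD using (gcd)
open import Data.Integer as ℤ using (ℤ; +_; _+_; _*_; _-_; -_; ∣_∣; -[1+_])
import Data.Integer.Properties as ZP
open import Data.Integer.Divisibility.Signed
  using (_∣_; divides; ∣ᵤ⇒∣; ∣⇒∣ᵤ; ∣m∣n⇒∣m+n; ∣m⇒∣-m; _∣?_)
open import Data.Integer.DivMod using (_%ℕ_; _/ℕ_; n%ℕd<d; a≡a%ℕn+[a/ℕn]*n)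
open import Data.Integer.Tactic.RingSolver using (solve-∀)
open import Data.Fin as F using (Fin; zero; suc; toℕ; fromℕ<; remQuot; combine; _↑ˡ_; _↑ʳ_)
import Data.Fin.Properties as FP
open import Data.Fin.Patterns using (0F; 1F; 2F)
open import Data.Product using (Σ; ∃; _,_; proj₁; proj₂; uncurry)
open import Data.Empty using (⊥-elim)
open import Function using (_∘_)
open import Relation.Nullary using (¬_; Dec; yes; no)
import Relation.Nullary.Decidable as Dec
open import Relation.Binary.PropositionalEquality
open import Algebra.Morphism.Structures using (module GroupMorphisms)

Σ-cong : ∀ {r} {f g : Fin r → ℤ} → f ≗ g → Σ[ f ] ≡ Σ[ g ]
Σ-cong {zero}  e = refl
Σ-cong {suc r} e = cong₂ _+_ (e zero) (Σ-cong (λ j → e (suc j)))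

Σ-+ : ∀ {r} (f g : Fin r → ℤ) → Σ[ (λ j → f j + g j) ] ≡ Σ[ f ] + Σ[ g ]
Σ-+ {zero}  f g = refl
Σ-+ {suc r} f g =
  trans (cong (_+_ (f zero + g zero)) (Σ-+ (λ j → f (suc j)) (λ j → g (suc j))))
        (interchange (f zero) (g zero) _ _)
  where
  interchange : ∀ a b c d → a + b + (c + d) ≡ a + c + (b + d)
  interchange = solve-∀

Σ-* : ∀ {r} (c : ℤ) (f : Fin r → ℤ) → Σ[ (λ j → c * f j) ] ≡ c * Σ[ f ]
Σ-* {zero}  c f = sym (ZP.*-zeroʳ c)
Σ-* {suc r} c f =
  trans (cong (_+_ (c * f zero)) (Σ-* c (λ j → f (suc j))))
        (sym (ZP.*-distribˡ-+ c (f zero) _))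

Σ-neg : ∀ {r} (f : Fin r → ℤ) → Σ[ (λ j → - f j) ] ≡ - Σ[ f ]
Σ-neg {zero}  f = refl
Σ-neg {suc r} f =
  trans (cong (_+_ (- f zero)) (Σ-neg (λ j → f (suc j))))
        (sym (ZP.neg-distrib-+ (f zero) _))

Σ-- : ∀ {r} (f g : Fin r → ℤ) → Σ[ (λ j → f j - g j) ] ≡ Σ[ f ] - Σ[ g ]
Σ-- f g = trans (Σ-+ f (λ j → - g j)) (cong (_+_ Σ[ f ]) (Σ-neg g))

Σ-zero : ∀ {r} → Σ[ (λ (_ : Fin r) → + 0) ] ≡ + 0
Σ-zero {zero}  = refl
Σ-zero {suc r} = trans (ZP.+-identityˡ _) (Σ-zero {r})

Σ-swap : ∀ {r s} (g : Fin r → Fin s → ℤ) →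
         Σ[ (λ i → Σ[ (λ j → g i j) ]) ] ≡ Σ[ (λ j → Σ[ (λ i → g i j) ]) ]
Σ-swap {zero}  {s} g = sym (Σ-zero {s})
Σ-swap {suc r}     g =
  trans (cong (_+_ Σ[ g zero ]) (Σ-swap (λ i → g (suc i))))
        (sym (Σ-+ (g zero) (λ j → Σ[ (λ i → g (suc i) j) ])))

Σ-single : ∀ {r} (f : Fin r → ℤ) (i : Fin r) → (∀ j → j ≢ i → f j ≡ + 0) → Σ[ f ] ≡ f i
Σ-single {suc r} f zero    f≡0 =
  trans (cong (_+_ (f zero)) (trans (Σ-cong (λ j → f≡0 (suc j) λ ())) (Σ-zero {r})))
        (ZP.+-identityʳ (f zero))
Σ-single {suc r} f (suc i) f≡0 =
  trans (cong₂ _+_ (f≡0 zero λ ())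
                   (Σ-single (λ j → f (suc j)) i λ j j≢i → f≡0 (suc j) (j≢i ∘ FP.suc-injective)))
        (ZP.+-identityˡ (f (suc i)))

Σ-↑ : ∀ a {b} (f : Fin (a ℕ.+ b) → ℤ) →
      Σ[ f ] ≡ Σ[ (λ i → f (i ↑ˡ b)) ] + Σ[ (λ j → f (a ↑ʳ j)) ]
Σ-↑ zero    f = sym (ZP.+-identityˡ Σ[ f ])
Σ-↑ (suc a) f =
  trans (cong (_+_ (f zero)) (Σ-↑ a (λ i → f (suc i))))
        (sym (ZP.+-assoc (f zero) _ _))

Σ-combine : ∀ a b (f : Fin (a ℕ.* b) → ℤ) →
            Σ[ f ] ≡ Σ[ (λ (x : Fin a) → Σ[ (λ (y : Fin b) → f (combine x y)) ]) ]
Σ-combine zero    b f = refl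
Σ-combine (suc a) b f =
  trans (Σ-↑ b f) (cong (_+_ Σ[ (λ y → f (y ↑ˡ (a ℕ.* b))) ]) (Σ-combine a b (λ j → f (b ↑ʳ j))))

module _ {r : ℕ} where

  infixl 6 _+ᵥ_ _-ᵥ_
  infixr 7 _*ᵥ_
  infix  8 -ᵥ_
  infix  4 _≐_

  0ᵥ : Vector r
  0ᵥ _ = + 0

  _+ᵥ_ _-ᵥ_ : Vector r → Vector r → Vector r
  (u +ᵥ v) i = u i + v i
  (u -ᵥ v) i = u i - v i

  -ᵥ_ : Vector r → Vector r
  (-ᵥ u) i = - u i

  _*ᵥ_ : ℤ → Vector r → Vector r
  (c *ᵥ u) i = c * u i

  _≐_ : Matrix r → Matrix r → Set
  P ≐ Q = ∀ i j → P i j ≡ Q i j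

  𝟙-diag : (i : Fin r) → 𝟙 i i ≡ + 1
  𝟙-diag i with i F.≟ i
  ... | yes _   = refl
  ... | no  i≢i = ⊥-elim (i≢i refl)

  𝟙-off : {i j : Fin r} → i ≢ j → 𝟙 i j ≡ + 0
  𝟙-off {i} {j} i≢j with i F.≟ j
  ... | yes i≡j = ⊥-elim (i≢j i≡j)
  ... | no  _   = refl

  Σ-𝟙 : (i : Fin r) → Σ[ 𝟙 i ] ≡ + 1
  Σ-𝟙 i = trans (Σ-single (𝟙 i) i λ j j≢i → 𝟙-off (j≢i ∘ sym)) (𝟙-diag i)

  ·v-cong : {P Q : Matrix r} {u v : Vector r} → P ≐ Q → u ≗ v → P ·v u ≗ Q ·v v
  ·v-cong P≐Q u≗v i = Σ-cong (λ j → cong₂ _*_ (P≐Q i j) (u≗v j))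

  ·v-congʳ : (P : Matrix r) {u v : Vector r} → u ≗ v → P ·v u ≗ P ·v v
  ·v-congʳ P = ·v-cong {P} (λ _ _ → refl)

  ·v-+ : (P : Matrix r) (u v : Vector r) → P ·v (u +ᵥ v) ≗ P ·v u +ᵥ P ·v v
  ·v-+ P u v i = trans (Σ-cong (λ j → ZP.*-distribˡ-+ (P i j) (u j) (v j)))
                       (Σ-+ (λ j → P i j * u j) (λ j → P i j * v j))

  ·v-* : (P : Matrix r) (c : ℤ) (u : Vector r) → P ·v (c *ᵥ u) ≗ c *ᵥ (P ·v u)
  ·v-* P c u i = trans (Σ-cong (λ j → swap (P i j) c (u j))) (Σ-* c (λ j → P i j * u j))
    where
    swap : ∀ a b d → a * (b * d) ≡ b * (a * d)
    swap = solve-∀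

  ·v-neg : (P : Matrix r) (u : Vector r) → P ·v (-ᵥ u) ≗ -ᵥ (P ·v u)
  ·v-neg P u i = trans (Σ-cong (λ j → sym (ZP.neg-distribʳ-* (P i j) (u j))))
                   (Σ-neg (λ j → P i j * u j))

  ·v-- : (P : Matrix r) (u v : Vector r) → P ·v (u -ᵥ v) ≗ P ·v u -ᵥ P ·v v
  ·v-- P u v i = trans (·v-+ P u (-ᵥ v) i) (cong (_+_ ((P ·v u) i)) (·v-neg P v i))

  ·v-0ᵥ : (P : Matrix r) → P ·v 0ᵥ ≗ 0ᵥ
  ·v-0ᵥ P i = trans (Σ-cong (λ j → ZP.*-zeroʳ (P i j))) (Σ-zero {r})

  𝟙·v : (u : Vector r) → 𝟙 ·v u ≗ u
  𝟙·v u i =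
    trans (Σ-single (λ j → 𝟙 i j * u j) i λ j j≢i →
             trans (cong (_* u j) (𝟙-off (j≢i ∘ sym))) (ZP.*-zeroˡ (u j)))
          (trans (cong (_* u i) (𝟙-diag i)) (ZP.*-identityˡ (u i)))

  ⊕·v : (P Q : Matrix r) (u : Vector r) → (P ⊕ Q) ·v u ≗ P ·v u +ᵥ Q ·v u
  ⊕·v P Q u i = trans (Σ-cong (λ j → ZP.*-distribʳ-+ (u j) (P i j) (Q i j)))
                  (Σ-+ (λ j → P i j * u j) (λ j → Q i j * u j))

  ⊝·v : (P : Matrix r) (u : Vector r) → (⊝ P) ·v u ≗ -ᵥ (P ·v u)
  ⊝·v P u i = trans (Σ-cong (λ j → sym (ZP.neg-distribˡ-* (P i j) (u j))))
                (Σ-neg (λ j → P i j * u j))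

  ⊖·v : (P Q : Matrix r) (u : Vector r) → (P ⊖ Q) ·v u ≗ P ·v u -ᵥ Q ·v u
  ⊖·v P Q u i = trans (⊕·v P (⊝ Q) u i) (cong (_+_ ((P ·v u) i)) (⊝·v Q u i))

  ⊕𝟙·v : (P : Matrix r) (u : Vector r) → (P ⊕ 𝟙) ·v u ≗ P ·v u +ᵥ u
  ⊕𝟙·v P u i = trans (⊕·v P 𝟙 u i) (cong (_+_ ((P ·v u) i)) (𝟙·v u i))

  ⊝𝟙·v : (u : Vector r) → (⊝ 𝟙) ·v u ≗ -ᵥ u
  ⊝𝟙·v u i = trans (⊝·v 𝟙 u i) (cong -_ (𝟙·v u i))

  ·v-Σ : ∀ {t} (P : Matrix r) (b : Fin t → Vector r) →
         P ·v (λ j → Σ[ (λ x → b x j) ]) ≗ (λ i → Σ[ (λ x → (P ·v b x) i) ])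
  ·v-Σ P b i = trans (Σ-cong (λ j → sym (Σ-* (P i j) (λ x → b x j)))) (Σ-swap (λ j x → P i j * b x j))

  ⊗·v : (P Q : Matrix r) (u : Vector r) → (P ⊗ Q) ·v u ≗ P ·v (Q ·v u)
  ⊗·v P Q u i = begin
    Σ[ (λ j → Σ[ (λ t → P i t * Q t j) ] * u j) ]
      ≡⟨ Σ-cong (λ j → trans (ZP.*-comm _ (u j)) (sym (Σ-* (u j) (λ t → P i t * Q t j)))) ⟩
    Σ[ (λ j → Σ[ (λ t → u j * (P i t * Q t j)) ]) ]
      ≡⟨ Σ-cong (λ j → Σ-cong (λ t → rearrange (u j) (P i t) (Q t j))) ⟩
    Σ[ (λ j → Σ[ (λ t → P i t * (Q t j * u j)) ]) ]
      ≡⟨ Σ-swap (λ j t → P i t * (Q t j * u j)) ⟩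
    Σ[ (λ t → Σ[ (λ j → P i t * (Q t j * u j)) ]) ]
      ≡⟨ Σ-cong (λ t → Σ-* (P i t) (λ j → Q t j * u j)) ⟩
    (P ·v (Q ·v u)) i
      ∎
    where
    open ≡-Reasoning
    rearrange : ∀ c a b → c * (a * b) ≡ a * (b * c)
    rearrange = solve-∀

InImage-resp : ∀ {r} (N : Matrix r) {v w : Vector r} → v ≗ w → InImage N v → InImage N w
InImage-resp N v≗w (u , v≗Nu) = u , λ i → trans (sym (v≗w i)) (v≗Nu i)

InImage-zero : ∀ {r} (N : Matrix r) {v : Vector r} → v ≗ 0ᵥ → InImage N v
InImage-zero N v≗0 = 0ᵥ , λ i → trans (v≗0 i) (sym (·v-0ᵥ N i))

module CokernelIsomorphism
  {r s} (L : Matrix r) (M : Matrix s) (φ : Vector r → Vector s)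
  (φ-cong     : ∀ {v w} → v ≗ w → φ v ≗ φ w)
  (φ-+        : ∀ v w → φ (v +ᵥ w) ≗ φ v +ᵥ φ w)
  (φ-*        : ∀ c v → φ (c *ᵥ v) ≗ c *ᵥ φ v)
  (φ-image    : ∀ v → InImage L v → InImage M (φ v))
  (φ-preimage : ∀ v → InImage M (φ v) → InImage L v)
  (ψ : Vector s → Vector r) (φ∘ψ : ∀ z → φ (ψ z) ≗ z)
  where

  φ-neg : ∀ v → φ (-ᵥ v) ≗ -ᵥ φ v
  φ-neg v i = begin
    φ (-ᵥ v) i           ≡⟨ φ-cong (λ j → sym (ZP.-1*i≡-i (v j))) i ⟩
    φ (- + 1 *ᵥ v) i     ≡⟨ φ-* (- + 1) v i ⟩
    - + 1 * φ v i        ≡⟨ ZP.-1*i≡-i (φ v i) ⟩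
    - φ v i              ∎
    where open ≡-Reasoning

  φ-- : ∀ v w → φ (v -ᵥ w) ≗ φ v -ᵥ φ w
  φ-- v w i = trans (φ-+ v (-ᵥ w) i) (cong (_+_ (φ v i)) (φ-neg w i))

  -- + 0 * i computes to + 0, so this is φ-* at c = + 0.
  φ-0ᵥ : φ 0ᵥ ≗ 0ᵥ
  φ-0ᵥ = φ-* (+ 0) 0ᵥ

  φ-torsion : ∀ {v} → IsTorsion L v → IsTorsion M (φ v)
  φ-torsion {v} (c , 1≤c , cv∈imL) =
    c , 1≤c , InImage-resp M (φ-* (+ c) v) (φ-image (+ c *ᵥ v) cv∈imL)

  ψ-torsion : ∀ {z} → IsTorsion M z → IsTorsion L (ψ z)
  ψ-torsion {z} (c , 1≤c , cz∈imM) =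
    c , 1≤c , φ-preimage (+ c *ᵥ ψ z) (InImage-resp M cz≗φ[cψz] cz∈imM)
    where
    cz≗φ[cψz] : + c *ᵥ z ≗ φ (+ c *ᵥ ψ z)
    cz≗φ[cψz] i = sym (trans (φ-* (+ c) (ψ z) i) (cong (_*_ (+ c)) (φ∘ψ z i)))

  φ-tors : Σ (Vector r) (IsTorsion L) → Σ (Vector s) (IsTorsion M)
  φ-tors (v , t) = φ v , φ-torsion t

  φ-tors-isGroupIsomorphism : GroupMorphisms.IsGroupIsomorphism (TorsCoker L) (TorsCoker M) φ-tors
  φ-tors-isGroupIsomorphism = record
    { isGroupMonomorphism = record
      { isGroupHomomorphism = record
        { isMonoidHomomorphism = record
          { isMagmaHomomorphism = record
            { isRelHomomorphism = record
              { cong = λ { {v , _} {w , _} v-w∈imL →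
                  InImage-resp M (φ-- v w) (φ-image (v -ᵥ w) v-w∈imL) } }
            ; homo = λ { (v , _) (w , _) → InImage-zero M λ i →
                trans (cong (_- (φ v i + φ w i)) (φ-+ v w i)) (ZP.+-inverseʳ (φ v i + φ w i)) }
            }
          ; ε-homo = InImage-zero M λ i → cong (_- + 0) (φ-0ᵥ i)
          }
        ; ⁻¹-homo = λ { (v , _) → InImage-zero M λ i →
            trans (cong (_- (- φ v i)) (φ-neg v i)) (ZP.+-inverseʳ (- φ v i)) }
        }
      ; injective = λ { {v , _} {w , _} φv-φw∈imM →
          φ-preimage (v -ᵥ w) (InImage-resp M (λ i → sym (φ-- v w i)) φv-φw∈imM) }
      }
    ; surjective = λ { (z , t) → (ψ z , ψ-torsion t) , λ { {x , _} x-ψz∈imL →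
        InImage-resp M (λ i → trans (φ-- x (ψ z) i) (cong (_-_ (φ x i)) (φ∘ψ z i)))
                     (φ-image (x -ᵥ ψ z) x-ψz∈imL) } }
    }

infix 4 _≡_[mod_]

record _≡_[mod_] (a b : ℤ) (n : ℕ) : Set where
  constructor ≡mod
  field divides-difference : + n ∣ a - b

open _≡_[mod_] using (divides-difference)

module _ {n : ℕ} where

  mod-resp : ∀ {a b a′ b′} → a - b ≡ a′ - b′ → a ≡ b [mod n ] → a′ ≡ b′ [mod n ]
  mod-resp eq (≡mod n∣a-b) = ≡mod (subst (+ n ∣_) eq n∣a-b)

  mod-reflexive : ∀ {a b} → a ≡ b → a ≡ b [mod n ]
  mod-reflexive {a} refl = ≡mod (divides (+ 0) (ZP.+-inverseʳ a))

  mod-sym : ∀ {a b} → a ≡ b [mod n ] → b ≡ a [mod n ]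
  mod-sym {a} {b} (≡mod n∣a-b) = ≡mod (subst (+ n ∣_) (negate a b) (∣m⇒∣-m n∣a-b))
    where
    negate : ∀ a b → - (a - b) ≡ b - a
    negate = solve-∀

  mod-trans : ∀ {a b c} → a ≡ b [mod n ] → b ≡ c [mod n ] → a ≡ c [mod n ]
  mod-trans {a} {b} {c} (≡mod n∣a-b) (≡mod n∣b-c) =
    ≡mod (subst (+ n ∣_) (ZP.+-minus-telescope a b c) (∣m∣n⇒∣m+n n∣a-b n∣b-c))

  toℕ-mod-injective : {s t : Fin n} → + toℕ s ≡ + toℕ t [mod n ] → s ≡ t
  toℕ-mod-injective {s} {t} (≡mod n∣s-t) = FP.toℕ-injective (ZP.+-injective (ZP.i-j≡0⇒i≡j _ _ s-t≡0))
    where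
    s-t≡0 : + toℕ s - + toℕ t ≡ + 0
    s-t≡0 = ZP.∣i∣≡0⇒i≡0 (multiple-below-n (∣⇒∣ᵤ n∣s-t) (begin-strict
      ∣ + toℕ s - + toℕ t ∣     ≡⟨ cong ∣_∣ (ZP.m-n≡m⊖n (toℕ s) (toℕ t)) ⟩
      ∣ toℕ s ℤ.⊖ toℕ t ∣       ≤⟨ ZP.∣m⊝n∣≤m⊔n (toℕ s) (toℕ t) ⟩
      toℕ s ℕ.⊔ toℕ t           <⟨ ℕP.⊔-lub (FP.toℕ<n s) (FP.toℕ<n t) ⟩
      n                         ∎))
      where
      open ℕP.≤-Reasoning
      multiple-below-n : ∀ {d} → n ℕD.∣ d → d ℕ.< n → d ≡ 0
      multiple-below-n {zero}  _   _   = refl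
      multiple-below-n {suc d} n∣d d<n = ⊥-elim (ℕD.>⇒∤ d<n n∣d)

  mod-representative : .{{_ : ℕ.NonZero n}} (c : ℤ) → ∃ λ (t : Fin n) → + toℕ t ≡ c [mod n ]
  mod-representative c = fromℕ< (n%ℕd<d c n) , ≡mod (divides (- (c /ℕ n)) (begin
    + toℕ (fromℕ< (n%ℕd<d c n)) - c          ≡⟨ cong (λ r → + r - c) (FP.toℕ-fromℕ< (n%ℕd<d c n)) ⟩
    + (c %ℕ n) - c                           ≡⟨ cong (_-_ (+ (c %ℕ n))) (a≡a%ℕn+[a/ℕn]*n c n) ⟩
    + (c %ℕ n) - (+ (c %ℕ n) + c /ℕ n * + n) ≡⟨ cancel (+ (c %ℕ n)) (c /ℕ n) (+ n) ⟩
    - (c /ℕ n) * + n                         ∎))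
    where
    open ≡-Reasoning
    cancel : ∀ r q d → r - (r + q * d) ≡ - q * d
    cancel = solve-∀

  [≡mod]-true : ∀ {a b} → a ≡ b [mod n ] → [ a ≡ b mod n ] ≡ + 1
  [≡mod]-true {a} {b} (≡mod n∣a-b) with n ℕD.∣? ∣ a - b ∣
  ... | yes _     = refl
  ... | no  n∤a-b = ⊥-elim (n∤a-b (∣⇒∣ᵤ n∣a-b))

  [≡mod]-false : ∀ {a b} → ¬ a ≡ b [mod n ] → [ a ≡ b mod n ] ≡ + 0
  [≡mod]-false {a} {b} a≢b with n ℕD.∣? ∣ a - b ∣
  ... | yes n∣a-b = ⊥-elim (a≢b (≡mod (∣ᵤ⇒∣ n∣a-b)))
  ... | no  _     = refl

  [≡mod]-cong : ∀ {a b a′ b′} → (a ≡ b [mod n ] → a′ ≡ b′ [mod n ]) →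
                (a′ ≡ b′ [mod n ] → a ≡ b [mod n ]) → [ a ≡ b mod n ] ≡ [ a′ ≡ b′ mod n ]
  [≡mod]-cong {a} {b} to from with Dec.map′ ≡mod divides-difference (+ n ∣? a - b)
  ... | yes a≡b = trans ([≡mod]-true a≡b) (sym ([≡mod]-true (to a≡b)))
  ... | no  a≢b = trans ([≡mod]-false a≢b) (sym ([≡mod]-false (a≢b ∘ from)))

  Σ-[≡mod]-* : ∀ {c} {t₀ : Fin n} (f : Fin n → ℤ) → + toℕ t₀ ≡ c [mod n ] →
               Σ[ (λ t → [ + toℕ t ≡ c mod n ] * f t) ] ≡ f t₀
  Σ-[≡mod]-* {c} {t₀} f t₀≡c =
    trans (Σ-single _ t₀ λ t t≢t₀ →
             trans (cong (_* f t) ([≡mod]-false (t≢t₀ ∘ unique t))) (ZP.*-zeroˡ (f t)))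
          (trans (cong (_* f t₀) ([≡mod]-true t₀≡c)) (ZP.*-identityˡ (f t₀)))
    where
    unique : ∀ t → + toℕ t ≡ c [mod n ] → t ≡ t₀
    unique t t≡c = toℕ-mod-injective (mod-trans t≡c (mod-sym t₀≡c))

-- The permutation matrix of i ↦ i + s on ℤ/nℤ; by definition T n = Shift n (+ 1) and T⁻¹ n = Shift n (- + 1).
Shift : (n : ℕ) → ℤ → Matrix n
Shift n s i j = [ + toℕ j ≡ + toℕ i + s mod n ]

module _ {n : ℕ} .{{_ : ℕ.NonZero n}} where

  Σ-Shift : (s : ℤ) (i : Fin n) → Σ[ Shift n s i ] ≡ + 1
  Σ-Shift s i = let t₀ , t₀≡i+s = mod-representative (+ toℕ i + s) in
    trans (Σ-cong (λ t → sym (ZP.*-identityʳ (Shift n s i t)))) (Σ-[≡mod]-* (λ _ → + 1) t₀≡i+s)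

  Shift-transpose : (s : ℤ) (i j : Fin n) → Shift n s j i ≡ Shift n (- s) i j
  Shift-transpose s i j = [≡mod]-cong (mod-sym ∘ mod-resp (move (+ toℕ i) (+ toℕ j) s))
                                      (mod-resp (sym (move (+ toℕ i) (+ toℕ j) s)) ∘ mod-sym)
    where
    move : ∀ x y s → x - (y + s) ≡ x + - s - y
    move = solve-∀

  Shift-zero : 𝟙 ≐ Shift n (+ 0)
  Shift-zero i j with i F.≟ j
  ... | yes refl = sym ([≡mod]-true (mod-reflexive (sym (ZP.+-identityʳ _))))
  ... | no  i≢j  = sym ([≡mod]-false λ j≡i+0 →
                     i≢j (sym (toℕ-mod-injective (mod-trans j≡i+0 (mod-reflexive (ZP.+-identityʳ _))))))

  Shift-⊗ : (s s′ : ℤ) → Shift n s ⊗ Shift n s′ ≐ Shift n (s + s′)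
  Shift-⊗ s s′ i j = let t₀ , t₀≡i+s = mod-representative (+ toℕ i + s) in
    trans (Σ-[≡mod]-* (λ t → Shift n s′ t j) t₀≡i+s)
          ([≡mod]-cong (λ j≡t₀+s′ → mod-trans j≡t₀+s′ (shifted t₀≡i+s))
                       (λ j≡i+[s+s′] → mod-trans j≡i+[s+s′] (mod-sym (shifted t₀≡i+s))))
    where
    shifted : ∀ {t} → t ≡ + toℕ i + s [mod n ] → t + s′ ≡ + toℕ i + (s + s′) [mod n ]
    shifted {t} = mod-resp (reassociate t (+ toℕ i) s s′)
      where
      reassociate : ∀ t i s s′ → t - (i + s) ≡ t + s′ - (i + (s + s′))
      reassociate = solve-∀

  Shift-^ᴹ : (s : ℤ) (e : ℕ) → Shift n s ^ᴹ e ≐ Shift n (s * + e)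
  Shift-^ᴹ s zero    i j = trans (Shift-zero i j) (cong (λ s′ → Shift n s′ i j) (sym (ZP.*-zeroʳ s)))
  Shift-^ᴹ s (suc e) i j = begin
    (Shift n s ⊗ (Shift n s ^ᴹ e)) i j  ≡⟨ Σ-cong (λ t → cong (_*_ (Shift n s i t)) (Shift-^ᴹ s e t j)) ⟩
    (Shift n s ⊗ Shift n (s * + e)) i j ≡⟨ Shift-⊗ s (s * + e) i j ⟩
    Shift n (s + s * + e) i j           ≡⟨ cong (λ s′ → Shift n s′ i j) (*-suc s (+ e)) ⟩
    Shift n (s * + suc e) i j           ∎
    where
    open ≡-Reasoning
    *-suc : ∀ s e → s + s * e ≡ s * (+ 1 + e)
    *-suc = solve-∀

  Tpow-Shift : (j : ℤ) → Tpow n j ≐ Shift n j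
  Tpow-Shift (+ e)    y y′ =
    trans (Shift-^ᴹ (+ 1) e y y′) (cong (λ s → Shift n s y y′) (ZP.*-identityˡ (+ e)))
  Tpow-Shift -[1+ e ] y y′ =
    trans (Shift-^ᴹ (- + 1) (suc e) y y′) (cong (λ s → Shift n s y y′) (ZP.-1*i≡-i (+ suc e)))

  blockMat-Shift : (j : ℤ) (y y′ : Fin n) →
                   blockMat n j y y′ ≡ + 4 * 𝟙 y y′ - Shift n j y y′ - Shift n (- j) y y′
  blockMat-Shift j y y′ =
    cong₂ _-_ (cong (_-_ (+ 4 * 𝟙 y y′)) (Tpow-Shift j y y′)) (Tpow-Shift (- j) y y′)

module Blocks (n : ℕ) {s : ℕ} where

  part : Vector (s ℕ.* n) → Fin s → Vector n
  part u x y = u (combine x y)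

  sumParts : Vector (s ℕ.* n) → Vector n
  sumParts u y = Σ[ (λ x → part u x y) ]

  block : Matrix (s ℕ.* n) → Fin s → Fin s → Matrix n
  block N x x′ y y′ = N (combine x y) (combine x′ y′)

  fromParts : (Fin s → Vector n) → Vector (s ℕ.* n)
  fromParts b i = uncurry b (remQuot {s} n i)

  -- By definition ΔAdj n k l m = fromBlocks (adjBlock n k l m) and MMat n k l m = fromBlocks (MBlocks n k l m).
  fromBlocks : (Fin s → Fin s → Matrix n) → Matrix (s ℕ.* n)
  fromBlocks B i j = B (proj₁ (remQuot {s} n i)) (proj₁ (remQuot {s} n j))
                     (proj₂ (remQuot {s} n i)) (proj₂ (remQuot {s} n j))

  part-fromParts : (b : Fin s → Vector n) (x : Fin s) → part (fromParts b) x ≗ b x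
  part-fromParts b x y = cong (uncurry b) (FP.remQuot-combine x y)

  block-fromBlocks : (B : Fin s → Fin s → Matrix n) (x x′ : Fin s) → block (fromBlocks B) x x′ ≐ B x x′
  block-fromBlocks B x x′ y y′ =
    cong₂ (λ p p′ → B (proj₁ p) (proj₁ p′) (proj₂ p) (proj₂ p′))
          (FP.remQuot-combine {s} {n} x y) (FP.remQuot-combine {s} {n} x′ y′)

  fromParts-cong : {b b′ : Fin s → Vector n} → (∀ x → b x ≗ b′ x) → fromParts b ≗ fromParts b′
  fromParts-cong b≗b′ i = uncurry b≗b′ (remQuot {s} n i)

  part-ext : {u v : Vector (s ℕ.* n)} → (∀ x → part u x ≗ part v x) → u ≗ v
  part-ext {u} {v} u≗v i =
    subst (λ i → u i ≡ v i) (FP.combine-remQuot {s} n i) (uncurry u≗v (remQuot {s} n i))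

  fromParts-≗ : {b : Fin s → Vector n} {u : Vector (s ℕ.* n)} → (∀ x → b x ≗ part u x) → fromParts b ≗ u
  fromParts-≗ {b} b≗u = part-ext λ x y → trans (part-fromParts b x y) (b≗u x y)

  part-·v : (N : Matrix (s ℕ.* n)) (u : Vector (s ℕ.* n)) (x : Fin s) (y : Fin n) →
            part (N ·v u) x y ≡ Σ[ (λ x′ → (block N x x′ ·v part u x′) y) ]
  part-·v N u x y = Σ-combine s n (λ j → N (combine x y) j * u j)

  𝟙-combine : (x x′ : Fin s) (y y′ : Fin n) → 𝟙 (combine x y) (combine x′ y′) ≡ 𝟙 x x′ * 𝟙 y y′
  𝟙-combine x x′ y y′ with x F.≟ x′ | y F.≟ y′
  ... | yes refl | yes refl = 𝟙-diag (combine x y)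
  ... | yes refl | no  y≢y′ = 𝟙-off (y≢y′ ∘ FP.combine-injectiveʳ x y x y′)
  ... | no  x≢x′ | _        = 𝟙-off (x≢x′ ∘ FP.combine-injectiveˡ x y x′ y′)

module Laplacian (n : ℕ) .{{_ : ℕ.NonZero n}} (k l m : ℤ) where
  open Blocks n

  diagBlock : Fin 3 → Matrix n
  diagBlock x = blockMat n (jump k l m x)

  adjBlock-same : ∀ x (y y′ : Fin n) → adjBlock n k l m x x y y′ ≡
                  Shift n (jump k l m x) y y′ + Shift n (jump k l m x) y′ y
  adjBlock-same x y y′ with x F.≟ x
  ... | yes _   = refl
  ... | no  x≢x = ⊥-elim (x≢x refl)

  adjBlock-distinct : ∀ {x x′} → x ≢ x′ → (y y′ : Fin n) → adjBlock n k l m x x′ y y′ ≡ 𝟙 y y′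
  adjBlock-distinct {x} {x′} x≢x′ y y′ with x F.≟ x′
  ... | yes x≡x′ = ⊥-elim (x≢x′ x≡x′)
  ... | no  _    with y F.≟ y′
  ...   | yes _ = refl
  ...   | no  _ = refl

  Σ-adjBlock : ∀ x x′ (y : Fin n) → Σ[ adjBlock n k l m x x′ y ] ≡ + 1 + 𝟙 x x′
  Σ-adjBlock x x′ y = by-cases (x F.≟ x′)
    where
    open ≡-Reasoning
    j = jump k l m x
    by-cases : Dec (x ≡ x′) → Σ[ adjBlock n k l m x x′ y ] ≡ + 1 + 𝟙 x x′
    by-cases (yes refl) = begin
      Σ[ adjBlock n k l m x x y ]
        ≡⟨ Σ-cong (adjBlock-same x y) ⟩
      Σ[ (λ y′ → Shift n j y y′ + Shift n j y′ y) ]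
        ≡⟨ Σ-+ (Shift n j y) (λ y′ → Shift n j y′ y) ⟩
      Σ[ Shift n j y ] + Σ[ (λ y′ → Shift n j y′ y) ]
        ≡⟨ cong (_+_ Σ[ Shift n j y ]) (Σ-cong (Shift-transpose j y)) ⟩
      Σ[ Shift n j y ] + Σ[ Shift n (- j) y ]
        ≡⟨ cong₂ _+_ (Σ-Shift j y) (Σ-Shift (- j) y) ⟩
      + 1 + + 1
        ≡⟨ cong (_+_ (+ 1)) (sym (𝟙-diag x)) ⟩
      + 1 + 𝟙 x x
        ∎
    by-cases (no x≢x′) = begin
      Σ[ adjBlock n k l m x x′ y ] ≡⟨ Σ-cong (adjBlock-distinct x≢x′ y) ⟩
      Σ[ 𝟙 y ]                     ≡⟨ Σ-𝟙 y ⟩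
      + 1 + + 0                    ≡⟨ cong (_+_ (+ 1)) (sym (𝟙-off x≢x′)) ⟩
      + 1 + 𝟙 x x′                 ∎

  ΔAdj-degree : ∀ x (y : Fin n) → Σ[ ΔAdj n k l m (combine x y) ] ≡ + 4
  ΔAdj-degree x y = begin
    Σ[ ΔAdj n k l m (combine x y) ]
      ≡⟨ Σ-combine 3 n (ΔAdj n k l m (combine x y)) ⟩
    Σ[ (λ x′ → Σ[ block (ΔAdj n k l m) x x′ y ]) ]
      ≡⟨ Σ-cong (λ x′ → Σ-cong (block-fromBlocks (adjBlock n k l m) x x′ y)) ⟩
    Σ[ (λ x′ → Σ[ adjBlock n k l m x x′ y ]) ]
      ≡⟨ Σ-cong (λ x′ → Σ-adjBlock x x′ y) ⟩
    Σ[ (λ x′ → + 1 + 𝟙 x x′) ]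
      ≡⟨ Σ-+ (λ _ → + 1) (𝟙 x) ⟩
    + 3 + Σ[ 𝟙 x ]
      ≡⟨ cong (_+_ (+ 3)) (Σ-𝟙 x) ⟩
    + 4
      ∎
    where open ≡-Reasoning

  ΔLaplacian-entry : ∀ v w → ΔLaplacian n k l m v w ≡ Σ[ ΔAdj n k l m v ] * 𝟙 v w - ΔAdj n k l m v w
  ΔLaplacian-entry v w with v F.≟ w
  ... | yes _ = cong (_- ΔAdj n k l m v w) (sym (ZP.*-identityʳ Σ[ ΔAdj n k l m v ]))
  ... | no  _ = sym (trans (cong (_- ΔAdj n k l m v w) (ZP.*-zeroʳ Σ[ ΔAdj n k l m v ]))
                           (ZP.+-identityˡ (- ΔAdj n k l m v w)))

  ΔLaplacian-block : ∀ x x′ (y y′ : Fin n) →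
    block (ΔLaplacian n k l m) x x′ y y′ ≡ + 4 * (𝟙 x x′ * 𝟙 y y′) - adjBlock n k l m x x′ y y′
  ΔLaplacian-block x x′ y y′ =
    trans (ΔLaplacian-entry (combine x y) (combine x′ y′))
          (cong₂ _-_ (cong₂ _*_ (ΔAdj-degree x y) (𝟙-combine x x′ y y′))
                     (block-fromBlocks (adjBlock n k l m) x x′ y y′))

  ΔLaplacian-diagonalBlock : ∀ x → block (ΔLaplacian n k l m) x x ≐ diagBlock x
  ΔLaplacian-diagonalBlock x y y′ = begin
    block (ΔLaplacian n k l m) x x y y′
      ≡⟨ ΔLaplacian-block x x y y′ ⟩
    + 4 * (𝟙 x x * 𝟙 y y′) - adjBlock n k l m x x y y′
      ≡⟨ cong₂ (λ a b → + 4 * (a * 𝟙 y y′) - b) (𝟙-diag x) (adjBlock-same x y y′) ⟩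
    + 4 * (+ 1 * 𝟙 y y′) - (Shift n j y y′ + Shift n j y′ y)
      ≡⟨ cong (λ a → + 4 * (+ 1 * 𝟙 y y′) - (Shift n j y y′ + a)) (Shift-transpose j y y′) ⟩
    + 4 * (+ 1 * 𝟙 y y′) - (Shift n j y y′ + Shift n (- j) y y′)
      ≡⟨ regroup (𝟙 y y′) (Shift n j y y′) (Shift n (- j) y y′) ⟩
    + 4 * 𝟙 y y′ - Shift n j y y′ - Shift n (- j) y y′
      ≡⟨ sym (blockMat-Shift j y y′) ⟩
    diagBlock x y y′
      ∎
    where
    open ≡-Reasoning
    j = jump k l m x
    regroup : ∀ a b c → + 4 * (+ 1 * a) - (b + c) ≡ + 4 * a - b - c
    regroup = solve-∀

  ΔLaplacian-offDiagonalBlock : ∀ {x x′} → x ≢ x′ → block (ΔLaplacian n k l m) x x′ ≐ ⊝ 𝟙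
  ΔLaplacian-offDiagonalBlock {x} {x′} x≢x′ y y′ =
    trans (ΔLaplacian-block x x′ y y′)
          (trans (cong₂ (λ a b → + 4 * (a * 𝟙 y y′) - b) (𝟙-off x≢x′) (adjBlock-distinct x≢x′ y y′))
                 (ZP.+-identityˡ (- 𝟙 y y′)))

  ΔLaplacian-block-·v : ∀ x x′ (v : Vector n) (y : Fin n) →
    (block (ΔLaplacian n k l m) x x′ ·v v) y ≡ 𝟙 x x′ * ((diagBlock x ⊕ 𝟙) ·v v) y - v y
  ΔLaplacian-block-·v x x′ v y = by-cases (x F.≟ x′)
    where
    open ≡-Reasoning
    [Dₓ+𝟙]v : ℤ
    [Dₓ+𝟙]v = ((diagBlock x ⊕ 𝟙) ·v v) y
    by-cases : Dec (x ≡ x′) → (block (ΔLaplacian n k l m) x x′ ·v v) y ≡ 𝟙 x x′ * [Dₓ+𝟙]v - v y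
    by-cases (yes refl) = begin
      (block (ΔLaplacian n k l m) x x ·v v) y ≡⟨ ·v-cong (ΔLaplacian-diagonalBlock x) (λ _ → refl) y ⟩
      (diagBlock x ·v v) y                    ≡⟨ add-cancel ((diagBlock x ·v v) y) (v y) ⟩
      + 1 * ((diagBlock x ·v v) y + v y) - v y
        ≡⟨ cong₂ (λ a b → a * b - v y) (sym (𝟙-diag x)) (sym (⊕𝟙·v (diagBlock x) v y)) ⟩
      𝟙 x x * [Dₓ+𝟙]v - v y                    ∎
      where
      add-cancel : ∀ a b → a ≡ + 1 * (a + b) - b
      add-cancel = solve-∀
    by-cases (no x≢x′) = begin
      (block (ΔLaplacian n k l m) x x′ ·v v) y ≡⟨ ·v-cong (ΔLaplacian-offDiagonalBlock x≢x′) (λ _ → refl) y ⟩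
      ((⊝ 𝟙) ·v v) y                           ≡⟨ ⊝𝟙·v v y ⟩
      - v y                                    ≡⟨ sym (ZP.+-identityˡ (- v y)) ⟩
      + 0 * [Dₓ+𝟙]v - v y                       ≡⟨ cong (λ a → a * [Dₓ+𝟙]v - v y) (sym (𝟙-off x≢x′)) ⟩
      𝟙 x x′ * [Dₓ+𝟙]v - v y                    ∎

  ΔLaplacian-part : (u : Vector (3 ℕ.* n)) (x : Fin 3) →
                    part (ΔLaplacian n k l m ·v u) x ≗ (diagBlock x ⊕ 𝟙) ·v part u x -ᵥ sumParts {3} u
  ΔLaplacian-part u x y = begin
    part (ΔLaplacian n k l m ·v u) x y
      ≡⟨ part-·v (ΔLaplacian n k l m) u x y ⟩
    Σ[ (λ x′ → (block (ΔLaplacian n k l m) x x′ ·v part u x′) y) ]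
      ≡⟨ Σ-cong (λ x′ → ΔLaplacian-block-·v x x′ (part u x′) y) ⟩
    Σ[ (λ x′ → 𝟙 x x′ * f x′ - part u x′ y) ]
      ≡⟨ Σ-- (λ x′ → 𝟙 x x′ * f x′) (λ x′ → part u x′ y) ⟩
    (𝟙 ·v f) x - sumParts {3} u y
      ≡⟨ cong (_- sumParts {3} u y) (𝟙·v f x) ⟩
    f x - sumParts {3} u y
      ∎
    where
    open ≡-Reasoning
    f : Fin 3 → ℤ
    f x′ = ((diagBlock x ⊕ 𝟙) ·v part u x′) y

  ΔLaplacian-fromParts : (b : Fin 3 → Vector n) (x : Fin 3) →
    part (ΔLaplacian n k l m ·v fromParts b) x ≗ (diagBlock x ⊕ 𝟙) ·v b x -ᵥ (λ y → Σ[ (λ x′ → b x′ y) ])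
  ΔLaplacian-fromParts b x y =
    trans (ΔLaplacian-part (fromParts b) x y)
          (cong₂ _-_ (·v-congʳ (diagBlock x ⊕ 𝟙) (part-fromParts b x) y)
                     (Σ-cong (λ x′ → part-fromParts b x′ y)))

module ΔGraph (n : ℕ) .{{_ : ℕ.NonZero n}} (k l m : ℤ) where
  open Blocks n
  open Laplacian n k l m using (ΔLaplacian-part; ΔLaplacian-fromParts)

  A B C : Matrix n
  A = blockMat n k
  B = blockMat n l
  C = blockMat n m

  L : Matrix (3 ℕ.* n)
  L = ΔLaplacian n k l m

  M : Matrix (2 ℕ.* n)
  M = MMat n k l m

  -- part with the number of blocks fixed, so that it can be applied to the literals 0F, 1F, 2F.
  part₂ : Vector (2 ℕ.* n) → Fin 2 → Vector n
  part₂ = part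

  part₃ : Vector (3 ℕ.* n) → Fin 3 → Vector n
  part₃ = part

  M-block : (a a′ : Fin 2) → block M a a′ ≐ MBlocks n k l m a a′
  M-block = block-fromBlocks (MBlocks n k l m)

  module _ (w : Vector (2 ℕ.* n)) {p q : Vector n} (w₀≗p : part₂ w 0F ≗ p) (w₁≗q : part₂ w 1F ≗ q) where

    M-part₀ : part₂ (M ·v w) 0F ≗ (-ᵥ p -ᵥ A ·v p) +ᵥ (q +ᵥ B ·v q)
    M-part₀ y = begin
      part₂ (M ·v w) 0F y
        ≡⟨ trans (part-·v {2} M w 0F y)
                 (cong₂ _+_ (·v-cong (M-block 0F 0F) w₀≗p y)
                            (trans (ZP.+-identityʳ _) (·v-cong (M-block 0F 1F) w₁≗q y))) ⟩
      (((⊝ 𝟙) ⊖ A) ·v p) y + ((𝟙 ⊕ B) ·v q) y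
        ≡⟨ cong₂ _+_ (trans (⊖·v (⊝ 𝟙) A p y) (cong (_- (A ·v p) y) (⊝𝟙·v p y)))
                     (trans (⊕·v 𝟙 B q y) (cong (_+ (B ·v q) y) (𝟙·v q y))) ⟩
      (- p y - (A ·v p) y) + (q y + (B ·v q) y)
        ∎
      where open ≡-Reasoning

    M-part₁ : part₂ (M ·v w) 1F ≗ (-ᵥ p +ᵥ C ·v (A ·v p)) +ᵥ (-ᵥ q -ᵥ C ·v q)
    M-part₁ y = begin
      part₂ (M ·v w) 1F y
        ≡⟨ trans (part-·v {2} M w 1F y)
                 (cong₂ _+_ (·v-cong (M-block 1F 0F) w₀≗p y)
                            (trans (ZP.+-identityʳ _) (·v-cong (M-block 1F 1F) w₁≗q y))) ⟩
      (((⊝ 𝟙) ⊕ (C ⊗ A)) ·v p) y + (((⊝ 𝟙) ⊖ C) ·v q) y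
        ≡⟨ cong₂ _+_ (trans (⊕·v (⊝ 𝟙) (C ⊗ A) p y) (cong₂ _+_ (⊝𝟙·v p y) (⊗·v C A p y)))
                     (trans (⊖·v (⊝ 𝟙) C q y) (cong (_- (C ·v q) y) (⊝𝟙·v q y))) ⟩
      (- p y + (C ·v (A ·v p)) y) + (- q y - (C ·v q) y)
        ∎
      where open ≡-Reasoning

  -- The last two blocks of E v for E = [[I,0,0],[-I,I,0],[C,0,I]], which satisfies E L = [[A,-I,-I],[M,0]].
  eliminateParts : Vector (3 ℕ.* n) → Fin 2 → Vector n
  eliminateParts v 0F = part₃ v 1F -ᵥ part₃ v 0F
  eliminateParts v 1F = part₃ v 2F +ᵥ C ·v part₃ v 0F

  eliminate : Vector (3 ℕ.* n) → Vector (2 ℕ.* n)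
  eliminate v = fromParts (eliminateParts v)

  eliminate-cong : ∀ {v w} → v ≗ w → eliminate v ≗ eliminate w
  eliminate-cong {v} {w} v≗w = fromParts-cong parts
    where
    parts : ∀ x → eliminateParts v x ≗ eliminateParts w x
    parts 0F y = cong₂ _-_ (v≗w _) (v≗w _)
    parts 1F y = cong₂ _+_ (v≗w _) (·v-congʳ C (λ y′ → v≗w _) y)

  eliminate-+ : ∀ v w → eliminate (v +ᵥ w) ≗ eliminate v +ᵥ eliminate w
  eliminate-+ v w = fromParts-cong parts
    where
    interchange : ∀ a b c d → a + b - (c + d) ≡ a - c + (b - d)
    interchange = solve-∀
    interchange′ : ∀ a b c d → a + b + (c + d) ≡ a + c + (b + d)
    interchange′ = solve-∀
    parts : ∀ x → eliminateParts (v +ᵥ w) x ≗ eliminateParts v x +ᵥ eliminateParts w x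
    parts 0F y = interchange (part₃ v 1F y) (part₃ w 1F y) (part₃ v 0F y) (part₃ w 0F y)
    parts 1F y = trans (cong (_+_ (part₃ v 2F y + part₃ w 2F y)) (·v-+ C (part₃ v 0F) (part₃ w 0F) y))
                       (interchange′ (part₃ v 2F y) (part₃ w 2F y) _ _)

  eliminate-* : ∀ c v → eliminate (c *ᵥ v) ≗ c *ᵥ eliminate v
  eliminate-* c v = fromParts-cong parts
    where
    distrib-minus : ∀ c a b → c * a - c * b ≡ c * (a - b)
    distrib-minus = solve-∀
    parts : ∀ x → eliminateParts (c *ᵥ v) x ≗ c *ᵥ eliminateParts v x
    parts 0F y = distrib-minus c (part₃ v 1F y) (part₃ v 0F y)
    parts 1F y = trans (cong (_+_ (c * part₃ v 2F y)) (·v-* C c (part₃ v 0F) y))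
                       (sym (ZP.*-distribˡ-+ c (part₃ v 2F y) _))

  keepFirstTwo : Vector (3 ℕ.* n) → Vector (2 ℕ.* n)
  keepFirstTwo u = fromParts (part₃ u ∘ F.inject₁)

  eliminate-L·v : ∀ u → eliminate (L ·v u) ≗ M ·v keepFirstTwo u
  eliminate-L·v u = fromParts-≗ parts
    where
    open ≡-Reasoning
    u′ : Fin 3 → Vector n
    u′ = part₃ u
    S : Vector n
    S = sumParts {3} u
    kept : ∀ a → part₂ (keepFirstTwo u) a ≗ u′ (F.inject₁ a)
    kept = part-fromParts (u′ ∘ F.inject₁)
    parts : ∀ a → eliminateParts (L ·v u) a ≗ part₂ (M ·v keepFirstTwo u) a
    parts 0F y = begin
      part₃ (L ·v u) 1F y - part₃ (L ·v u) 0F y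
        ≡⟨ cong₂ _-_ (ΔLaplacian-part u 1F y) (ΔLaplacian-part u 0F y) ⟩
      ((B ⊕ 𝟙) ·v u′ 1F) y - S y - (((A ⊕ 𝟙) ·v u′ 0F) y - S y)
        ≡⟨ cong₂ (λ a b → a - S y - (b - S y)) (⊕𝟙·v B (u′ 1F) y) (⊕𝟙·v A (u′ 0F) y) ⟩
      (B ·v u′ 1F) y + u′ 1F y - S y - ((A ·v u′ 0F) y + u′ 0F y - S y)
        ≡⟨ rearrange (u′ 0F y) (u′ 1F y) ((A ·v u′ 0F) y) ((B ·v u′ 1F) y) (S y) ⟩
      (- u′ 0F y - (A ·v u′ 0F) y) + (u′ 1F y + (B ·v u′ 1F) y)
        ≡⟨ sym (M-part₀ (keepFirstTwo u) (kept 0F) (kept 1F) y) ⟩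
      part₂ (M ·v keepFirstTwo u) 0F y
        ∎
      where
      rearrange : ∀ u₀ u₁ Au₀ Bu₁ s → Bu₁ + u₁ - s - (Au₀ + u₀ - s) ≡ (- u₀ - Au₀) + (u₁ + Bu₁)
      rearrange = solve-∀
    parts 1F y = begin
      part₃ (L ·v u) 2F y + (C ·v part₃ (L ·v u) 0F) y
        ≡⟨ cong₂ _+_ (ΔLaplacian-part u 2F y) (·v-congʳ C (ΔLaplacian-part u 0F) y) ⟩
      ((C ⊕ 𝟙) ·v u′ 2F) y - S y + (C ·v ((A ⊕ 𝟙) ·v u′ 0F -ᵥ S)) y
        ≡⟨ cong₂ (λ a b → a - S y + b) (⊕𝟙·v C (u′ 2F) y) C[[A+𝟙]u₀-S] ⟩
      (C ·v u′ 2F) y + u′ 2F y - S y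
        + ((C ·v (A ·v u′ 0F)) y + (C ·v u′ 0F) y - Σ[ (λ x → (C ·v u′ x) y) ])
        ≡⟨ rearrange (u′ 0F y) (u′ 1F y) (u′ 2F y)
                     ((C ·v u′ 0F) y) ((C ·v u′ 1F) y) ((C ·v u′ 2F) y) ((C ·v (A ·v u′ 0F)) y) ⟩
      (- u′ 0F y + (C ·v (A ·v u′ 0F)) y) + (- u′ 1F y - (C ·v u′ 1F) y)
        ≡⟨ sym (M-part₁ (keepFirstTwo u) (kept 0F) (kept 1F) y) ⟩
      part₂ (M ·v keepFirstTwo u) 1F y
        ∎
      where
      C[[A+𝟙]u₀-S] : (C ·v ((A ⊕ 𝟙) ·v u′ 0F -ᵥ S)) y ≡
                     (C ·v (A ·v u′ 0F)) y + (C ·v u′ 0F) y - Σ[ (λ x → (C ·v u′ x) y) ]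
      C[[A+𝟙]u₀-S] =
        trans (·v-- C ((A ⊕ 𝟙) ·v u′ 0F) S y)
              (cong₂ _-_ (trans (·v-congʳ C (⊕𝟙·v A (u′ 0F)) y) (·v-+ C (A ·v u′ 0F) (u′ 0F) y))
                         (·v-Σ C u′ y))
      rearrange : ∀ u₀ u₁ u₂ Cu₀ Cu₁ Cu₂ CAu₀ →
        Cu₂ + u₂ - (u₀ + (u₁ + (u₂ + + 0))) + (CAu₀ + Cu₀ - (Cu₀ + (Cu₁ + (Cu₂ + + 0))))
          ≡ (- u₀ + CAu₀) + (- u₁ - Cu₁)
      rearrange = solve-∀

  preimageParts : Vector (2 ℕ.* n) → Vector (3 ℕ.* n) → Fin 3 → Vector n
  preimageParts w d 0F = part₂ w 0F
  preimageParts w d 1F = part₂ w 1F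
  preimageParts w d 2F = A ·v part₂ w 0F -ᵥ part₂ w 1F -ᵥ part₃ d 0F

  eliminate-preimage : ∀ d → InImage M (eliminate d) → InImage L d
  eliminate-preimage d (w , elim-d≗Mw) = fromParts σ , part-ext λ x y → sym (parts x y)
    where
    open ≡-Reasoning
    σ : Fin 3 → Vector n
    σ = preimageParts w d
    p q d₀ s S : Vector n
    p = part₂ w 0F
    q = part₂ w 1F
    d₀ = part₃ d 0F
    s = σ 2F
    S y = Σ[ (λ x → σ x y) ]
    hyp : ∀ a → eliminateParts d a ≗ part₂ (M ·v w) a
    hyp a y = trans (sym (part-fromParts (eliminateParts d) a y)) (elim-d≗Mw (combine a y))
    parts : ∀ x y → part₃ (L ·v fromParts σ) x y ≡ part₃ d x y
    parts 0F y = begin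
      part₃ (L ·v fromParts σ) 0F y ≡⟨ ΔLaplacian-fromParts σ 0F y ⟩
      ((A ⊕ 𝟙) ·v p) y - S y        ≡⟨ cong (_- S y) (⊕𝟙·v A p y) ⟩
      (A ·v p) y + p y - S y        ≡⟨ cancel (p y) (q y) ((A ·v p) y) (d₀ y) ⟩
      d₀ y                          ∎
      where
      cancel : ∀ p q Ap d₀ → Ap + p - (p + (q + (Ap - q - d₀ + + 0))) ≡ d₀
      cancel = solve-∀
    parts 1F y = begin
      part₃ (L ·v fromParts σ) 1F y
        ≡⟨ ΔLaplacian-fromParts σ 1F y ⟩
      ((B ⊕ 𝟙) ·v q) y - S y
        ≡⟨ cong (_- S y) (⊕𝟙·v B q y) ⟩
      (B ·v q) y + q y - S y
        ≡⟨ rearrange (p y) (q y) ((A ·v p) y) ((B ·v q) y) (d₀ y) ⟩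
      (- p y - (A ·v p) y) + (q y + (B ·v q) y) + d₀ y
        ≡⟨ cong (_+ d₀ y) (sym (trans (hyp 0F y) (M-part₀ w (λ _ → refl) (λ _ → refl) y))) ⟩
      part₃ d 1F y - d₀ y + d₀ y
        ≡⟨ minus-plus (part₃ d 1F y) (d₀ y) ⟩
      part₃ d 1F y
        ∎
      where
      rearrange : ∀ p q Ap Bq d₀ → Bq + q - (p + (q + (Ap - q - d₀ + + 0))) ≡ (- p - Ap) + (q + Bq) + d₀
      rearrange = solve-∀
      minus-plus : ∀ a b → a - b + b ≡ a
      minus-plus = solve-∀
    parts 2F y = begin
      part₃ (L ·v fromParts σ) 2F y
        ≡⟨ ΔLaplacian-fromParts σ 2F y ⟩
      ((C ⊕ 𝟙) ·v s) y - S y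
        ≡⟨ cong (_- S y) (⊕𝟙·v C s y) ⟩
      (C ·v s) y + s y - S y
        ≡⟨ cong (λ a → a + s y - S y)
                (trans (·v-- C (A ·v p -ᵥ q) d₀ y) (cong (_- (C ·v d₀) y) (·v-- C (A ·v p) q y))) ⟩
      (C ·v (A ·v p)) y - (C ·v q) y - (C ·v d₀) y + s y - S y
        ≡⟨ rearrange (p y) (q y) (s y) ((C ·v (A ·v p)) y) ((C ·v q) y) ((C ·v d₀) y) ⟩
      (- p y + (C ·v (A ·v p)) y) + (- q y - (C ·v q) y) - (C ·v d₀) y
        ≡⟨ cong (_- (C ·v d₀) y) (sym (trans (hyp 1F y) (M-part₁ w (λ _ → refl) (λ _ → refl) y))) ⟩
      part₃ d 2F y + (C ·v d₀) y - (C ·v d₀) y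
        ≡⟨ plus-minus (part₃ d 2F y) ((C ·v d₀) y) ⟩
      part₃ d 2F y
        ∎
      where
      rearrange : ∀ p q s CAp Cq Cd₀ →
        CAp - Cq - Cd₀ + s - (p + (q + (s + + 0))) ≡ (- p + CAp) + (- q - Cq) - Cd₀
      rearrange = solve-∀
      plus-minus : ∀ a b → a + b - b ≡ a
      plus-minus = solve-∀

  eliminate-image : ∀ v → InImage L v → InImage M (eliminate v)
  eliminate-image v (u , v≗Lu) =
    keepFirstTwo u , λ i → trans (eliminate-cong v≗Lu i) (eliminate-L·v u i)

  embedParts : Vector (2 ℕ.* n) → Fin 3 → Vector n
  embedParts z 0F = 0ᵥ
  embedParts z 1F = part₂ z 0F
  embedParts z 2F = part₂ z 1F

  embed : Vector (2 ℕ.* n) → Vector (3 ℕ.* n)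
  embed z = fromParts (embedParts z)

  eliminate-embed : ∀ z → eliminate (embed z) ≗ z
  eliminate-embed z = fromParts-≗ parts
    where
    embed≗ : ∀ x → part₃ (embed z) x ≗ embedParts z x
    embed≗ = part-fromParts (embedParts z)
    parts : ∀ a → eliminateParts (embed z) a ≗ part₂ z a
    parts 0F y = trans (cong₂ _-_ (embed≗ 1F y) (embed≗ 0F y)) (ZP.+-identityʳ (part₂ z 0F y))
    parts 1F y = trans (cong₂ _+_ (embed≗ 2F y) (trans (·v-congʳ C (embed≗ 0F) y) (·v-0ᵥ C y)))
                       (ZP.+-identityʳ (part₂ z 1F y))

theorem1 : (n : ℕ) → 1 ≤ n → (k l m : ℤ) →
    gcd (gcd (gcd ∣ k ∣ ∣ l ∣) ∣ m ∣) n ≡ 1 →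
    ∃ λ f → GroupMorphisms.IsGroupIsomorphism (JacΔ n k l m) (TorsCoker (MMat n k l m)) f
theorem1 n 1≤n k l m _ = φ-tors , φ-tors-isGroupIsomorphism
  where
  instance
    n≢0 : ℕ.NonZero n
    n≢0 = ℕ.>-nonZero 1≤n
  open ΔGraph n k l m
  open CokernelIsomorphism L M eliminate eliminate-cong eliminate-+ eliminate-*
                           eliminate-image eliminate-preimage embed eliminate-embed
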